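{- Let $\Delta'_{\alpha}$ and $\nabla'_{\!\beta}$ be adjoint to $\Delta_{\alpha}$ and $\nabla_{\!\beta}$, respectively (in the sense fixed in the context: $\Delta'_\alpha,\nabla'_\beta$ are the backward modalities $\overleftarrow{\Box},\overleftarrow{\Diamond}$ of the same shape and polarity as $\Delta_\alpha,\nabla_\beta$). Let $\mathbf{A}$ be a tense $\mathcal{L}$-modal algebra appropriate for $(\Delta'_{\alpha}, \nabla'_{\!\beta})^*$. Then the adjoint of $\mathbf{A}$ satisfies $(\Delta_{\alpha}, \nabla_{\!\beta})^{*}$ if and only if $\mathbf{A}$ satisfies $(\Delta'_{\alpha}, \nabla'_{\!\beta})^{*}$.
   Context: All lattices are bounded distributive lattices. For a polarity $\alpha\in\{+,-\}$ there are four forward modal operators on a distributive lattice: $\Box_+$ preserves finite meets (incl. $\top$); $\Diamond_+$ preserves finite joins (incl. $\bot$); $\Box_-(a\vee b)=\Box_-a\wedge\Box_-b$, $\Box_-\bot=\top$; $\Diamond_-(a\wedge b)=\Diamond_-a\vee\Diamond_-b$, $\Diamond_-\top=\bot$. There are four backward modalities, written here $\overleftarrow{\Box}_\alpha$ (backward box) and $\overleftarrow{\Diamond}_\alpha$ (backward diamond), forming adjoint pairs with the forward ones: $a\le\Box_+b\iff\overleftarrow{\Diamond}_+a\le b$; $\Diamond_+a\le b\iff a\le\overleftarrow{\Box}_+b$; $a\le\Box_-b\iff b\le\overleftarrow{\Box}_-a$; $\Diamond_-a\le b\iff\overleftarrow{\Diamond}_-b\le a$. A tense modal algebra is a distributive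 lattice with such adjoint pairs of forward and backward operators. The adjoint of a tense modal algebra is the same lattice where each operation previously interpreting $\overleftarrow{\Box}_\alpha$ (resp. $\overleftarrow{\Diamond}_\alpha$) now interprets $\Box_\alpha$ (resp. $\Diamond_\alpha$) and vice versa (e.g. the adjoint of $\langle A,\Box_+,\overleftarrow{\Diamond}_+\rangle$ is $\langle A,\Diamond_+,\overleftarrow{\Box}_+\rangle$ with $\Diamond_+a=\overleftarrow{\Diamond}_+a$, $\overleftarrow{\Box}_+a=\Box_+a$). Here $\rightarrow$ is Heyting implication ($a\wedge b\le c\iff b\le a\rightarrow c$) and $-$ is co-implication ($a\le b\vee c\iff a-b\le c$). Forward locality equations: $(\Diamond_+,\Box_+)^*$: $\Box_+a\wedge\Diamond_+b\le\Diamond_+(a\wedge b)$; $(\Diamond_-,\Box_-)^*$: $\Box_-a\wedge\Diamond_-b\le\Diamond_-(a\vee b)$; $(\Box_+,\Diamond_+)^*$: $\Box_+(a\vee b)\le\Box_+a\vee\Diamond_+b$; $(\Box_-,\Diamond_-)^*$: $\Box_-(a\wedge b)\le\Box_-a\vee\Diamond_-b$; $(\Diamond_+,\Box_-)^*$: $\Box_-a\wedge\Diamond_+a\le\bot$; $(\Diamond_-,\Box_+)^*$: $\Box_+a\wedge\Diamond_-a\le\bot$; $(\Box_+,\Diamond_-)^*$: $\top\le\Box_+a\vee\Diamond_-a$; $(\Box_-,\Diamond_+)^*$: $\top\le\Box_-a\vee\Diamond_+a$. Backward locality equations: $(\overleftarrow{\Diamond}_+,\overleftarrow{\Box}_+)^*$: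 $\Diamond_+a\rightarrow\Box_+b\le\Box_+(a\rightarrow b)$; $(\overleftarrow{\Diamond}_-,\overleftarrow{\Box}_-)^*$: $\Diamond_-(a\rightarrow b)\le\Diamond_-b-\Box_-a$; $(\overleftarrow{\Box}_+,\overleftarrow{\Diamond}_+)^*$: $\Diamond_+(b-a)\le\Diamond_+b-\Box_+a$; $(\overleftarrow{\Box}_-,\overleftarrow{\Diamond}_-)^*$: $\Diamond_-a\rightarrow\Box_-b\le\Box_-(b-a)$; $(\overleftarrow{\Diamond}_+,\overleftarrow{\Box}_-)^*$: $\Box_-a\le\Box_+(a\rightarrow\bot)$; $(\overleftarrow{\Diamond}_-,\overleftarrow{\Box}_+)^*$: $\Diamond_-(a\rightarrow\bot)\le\Diamond_+a$; $(\overleftarrow{\Box}_+,\overleftarrow{\Diamond}_-)^*$: $\Diamond_+(\top-a)\le\Diamond_-a$; $(\overleftarrow{\Box}_-,\overleftarrow{\Diamond}_+)^*$: $\Box_+a\le\Box_-(\top-a)$. An algebra is appropriate for an equation if it is a Heyting, co-Heyting or bi-Heyting algebra according to which of $\rightarrow$, $-$ occur in the equation. -}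

module Defs where

open import Level using (Level; _⊔_) renaming (suc to lsuc)
open import Data.Product using (_×_; _,_)
open import Function.Bundles using (_⇔_)
import Function.Properties.Equivalence as ⇔
open import Algebra.Definitions using (_DistributesOverˡ_)
open import Relation.Binary.Lattice.Bundles using (BoundedLattice)

record BDLattice c ℓ₁ ℓ₂ : Set (lsuc (c ⊔ ℓ₁ ⊔ ℓ₂)) where
  field
    boundedLattice : BoundedLattice c ℓ₁ ℓ₂
  open BoundedLattice boundedLattice public
  field
    ∧-distribˡ-∨ : _DistributesOverˡ_ _≈_ _∧_ _∨_

data Shape : Set where
  box dia : Shape

data Pol : Set where
  pos neg : Pol

flip : Shape → Shape
flip box = dia
flip dia = box

-- Shape of the operator adjoint to an operator of shape s and polarity p:
-- □+ ~ ◁◇+,  ◇+ ~ ◁□+,  □- ~ ◁□-,  ◇- ~ ◁◇-.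
dual : Shape → Pol → Shape
dual s pos = flip s
dual s neg = s

module _ {c ℓ₁ ℓ₂} (L : BDLattice c ℓ₁ ℓ₂) where
  open BDLattice L

  Laws : Shape → Pol → (Carrier → Carrier) → Set (c ⊔ ℓ₁)
  Laws box pos f = (∀ a b → f (a ∧ b) ≈ (f a ∧ f b)) × (f ⊤ ≈ ⊤)
  Laws dia pos f = (∀ a b → f (a ∨ b) ≈ (f a ∨ f b)) × (f ⊥ ≈ ⊥)
  Laws box neg f = (∀ a b → f (a ∨ b) ≈ (f a ∧ f b)) × (f ⊥ ≈ ⊤)
  Laws dia neg f = (∀ a b → f (a ∧ b) ≈ (f a ∨ f b)) × (f ⊤ ≈ ⊥)

  Adj : Shape → Pol → (f g : Carrier → Carrier) → Set (c ⊔ ℓ₂)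
  Adj box pos f g = ∀ a b → (a ≤ f b) ⇔ (g a ≤ b)
  Adj dia pos f g = ∀ a b → (f a ≤ b) ⇔ (a ≤ g b)
  Adj box neg f g = ∀ a b → (a ≤ f b) ⇔ (b ≤ g a)
  Adj dia neg f g = ∀ a b → (f a ≤ b) ⇔ (g b ≤ a)

  record ModalPair (s : Shape) (p : Pol) : Set (c ⊔ ℓ₁ ⊔ ℓ₂) where
    field
      fwd     : Carrier → Carrier
      bwd     : Carrier → Carrier
      fwdLaws : Laws s p fwd
      bwdLaws : Laws (dual s p) p bwd
      adj     : Adj s p fwd bwd

  swapPair : ∀ {s p} → ModalPair s p → ModalPair (dual s p) p
  swapPair {box} {pos} P = record
    { fwd = bwd ; bwd = fwd ; fwdLaws = bwdLaws ; bwdLaws = fwdLaws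
    ; adj = λ a b → ⇔.sym (adj a b) }
    where open ModalPair P
  swapPair {dia} {pos} P = record
    { fwd = bwd ; bwd = fwd ; fwdLaws = bwdLaws ; bwdLaws = fwdLaws
    ; adj = λ a b → ⇔.sym (adj a b) }
    where open ModalPair P
  swapPair {box} {neg} P = record
    { fwd = bwd ; bwd = fwd ; fwdLaws = bwdLaws ; bwdLaws = fwdLaws
    ; adj = λ a b → ⇔.sym (adj b a) }
    where open ModalPair P
  swapPair {dia} {neg} P = record
    { fwd = bwd ; bwd = fwd ; fwdLaws = bwdLaws ; bwdLaws = fwdLaws
    ; adj = λ a b → ⇔.sym (adj b a) }
    where open ModalPair P

  record HeytingImp : Set (c ⊔ ℓ₂) where
    infixr 5 _⇒_
    field
      _⇒_      : Carrier → Carrier → Carrier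
      residual : ∀ a b c → ((a ∧ b) ≤ c) ⇔ (b ≤ (a ⇒ c))

  record CoHeytingImp : Set (c ⊔ ℓ₂) where
    infixl 5 _∸_
    field
      _∸_      : Carrier → Carrier → Carrier
      residual : ∀ a b c → (a ≤ (b ∨ c)) ⇔ ((a ∸ b) ≤ c)

record TenseAlg c ℓ₁ ℓ₂ (s₁ : Shape) (p₁ : Pol) (s₂ : Shape) (p₂ : Pol)
       : Set (lsuc (c ⊔ ℓ₁ ⊔ ℓ₂)) where
  field
    lattice : BDLattice c ℓ₁ ℓ₂
    m₁      : ModalPair lattice s₁ p₁
    m₂      : ModalPair lattice s₂ p₂

  open BDLattice lattice public using (Carrier)

  fwd₁ fwd₂ bwd₁ bwd₂ : Carrier → Carrier
  fwd₁ = ModalPair.fwd m₁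
  fwd₂ = ModalPair.fwd m₂
  bwd₁ = ModalPair.bwd m₁
  bwd₂ = ModalPair.bwd m₂

adjoint : ∀ {c ℓ₁ ℓ₂ s₁ p₁ s₂ p₂} → TenseAlg c ℓ₁ ℓ₂ s₁ p₁ s₂ p₂ →
          TenseAlg c ℓ₁ ℓ₂ (dual s₁ p₁) p₁ (dual s₂ p₂) p₂
adjoint A = record
  { lattice = lattice
  ; m₁ = swapPair lattice m₁
  ; m₂ = swapPair lattice m₂ }
  where open TenseAlg A

-- The pair (Δ_α, ∇_β) is encoded by (s, α, β): Δ has shape s, ∇ has
-- shape flip s.  E.g. (dia, pos, pos) = (◇+, □+), (box, neg, pos) = (□-, ◇+).

module _ {c ℓ₁ ℓ₂} (L : BDLattice c ℓ₁ ℓ₂) where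
  open BDLattice L

  -- Forward locality equation (Δ_α, ∇_β)^*, with d interpreting Δ_α and
  -- n interpreting ∇_β.
  FwdEq : Shape → Pol → Pol → (d n : Carrier → Carrier) → Set (c ⊔ ℓ₂)
  FwdEq dia pos pos d n = ∀ a b → (n a ∧ d b) ≤ d (a ∧ b)
  FwdEq dia neg neg d n = ∀ a b → (n a ∧ d b) ≤ d (a ∨ b)
  FwdEq box pos pos d n = ∀ a b → d (a ∨ b) ≤ (d a ∨ n b)
  FwdEq box neg neg d n = ∀ a b → d (a ∧ b) ≤ (d a ∨ n b)
  FwdEq dia pos neg d n = ∀ a → (n a ∧ d a) ≤ ⊥
  FwdEq dia neg pos d n = ∀ a → (n a ∧ d a) ≤ ⊥
  FwdEq box pos neg d n = ∀ a → ⊤ ≤ (d a ∨ n a)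
  FwdEq box neg pos d n = ∀ a → ⊤ ≤ (d a ∨ n a)

  -- Appropriateness for the backward equation (Δ'_α, ∇'_β)^*:
  -- Heyting / co-Heyting / bi-Heyting structure according to which of
  -- → and − occur in it.
  Appropriate : Shape → Pol → Pol → Set (c ⊔ ℓ₂)
  Appropriate dia pos pos = HeytingImp L
  Appropriate dia neg neg = HeytingImp L × CoHeytingImp L
  Appropriate box pos pos = CoHeytingImp L
  Appropriate box neg neg = HeytingImp L × CoHeytingImp L
  Appropriate dia pos neg = HeytingImp L
  Appropriate dia neg pos = HeytingImp L
  Appropriate box pos neg = CoHeytingImp L
  Appropriate box neg pos = CoHeytingImp L

  -- Backward locality equation (Δ'_α, ∇'_β)^*, written (as in the paper)
  -- with the forward operators: D is the forward operator adjoint to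
  -- Δ'_α and N the forward operator adjoint to ∇'_β.
  BwdEq : (s : Shape) (α β : Pol) → Appropriate s α β →
          (D N : Carrier → Carrier) → Set (c ⊔ ℓ₂)
  -- (◁◇+,◁□+)^* : ◇+a → □+b ≤ □+(a → b)      D = □+, N = ◇+
  BwdEq dia pos pos H D N = ∀ a b → (N a ⇒ D b) ≤ D (a ⇒ b)
    where open HeytingImp H
  -- (◁◇-,◁□-)^* : ◇-(a → b) ≤ ◇-b − □-a       D = ◇-, N = □-
  BwdEq dia neg neg (H , K) D N = ∀ a b → D (a ⇒ b) ≤ (D b ∸ N a)
    where open HeytingImp H
          open CoHeytingImp K
  -- (◁□+,◁◇+)^* : ◇+(b − a) ≤ ◇+b − □+a       D = ◇+, N = □+
  BwdEq box pos pos K D N = ∀ a b → D (b ∸ a) ≤ (D b ∸ N a)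
    where open CoHeytingImp K
  -- (◁□-,◁◇-)^* : ◇-a → □-b ≤ □-(b − a)       D = □-, N = ◇-
  BwdEq box neg neg (H , K) D N = ∀ a b → (N a ⇒ D b) ≤ D (b ∸ a)
    where open HeytingImp H
          open CoHeytingImp K
  -- (◁◇+,◁□-)^* : □-a ≤ □+(a → ⊥)             D = □+, N = □-
  BwdEq dia pos neg H D N = ∀ a → N a ≤ D (a ⇒ ⊥)
    where open HeytingImp H
  -- (◁◇-,◁□+)^* : ◇-(a → ⊥) ≤ ◇+a             D = ◇-, N = ◇+
  BwdEq dia neg pos H D N = ∀ a → D (a ⇒ ⊥) ≤ N a
    where open HeytingImp H
  -- (◁□+,◁◇-)^* : ◇+(⊤ − a) ≤ ◇-a             D = ◇+, N = ◇-
  BwdEq box pos neg K D N = ∀ a → D (⊤ ∸ a) ≤ N a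
    where open CoHeytingImp K
  -- (◁□-,◁◇+)^* : □+a ≤ □-(⊤ − a)             D = □-, N = □+
  BwdEq box neg pos K D N = ∀ a → N a ≤ D (⊤ ∸ a)
    where open CoHeytingImp K

-- Write d, n for the backward operators of A (the forward operators of
-- its adjoint) and D, N for their forward partners.  Each locality
-- equation for d, n is transported to its backward form, and back, by
-- transposing across the adjunction between d and D and across
-- residuation (∧ against ⇒, or ∨ against ∸); the units and counits of
-- the adjunction between n and N supply the missing comparisons.
module Submission where

open import Defs
open import Data.Product using (_,_)
open import Function.Bundles using (_⇔_; mk⇔; Equivalence)
import Function.Properties.Equivalence as ⇔
open import Relation.Binary.Bundles using (Poset)
import Relation.Binary.Reasoning.PartialOrder as ≤-Reasoning
import Relation.Binary.Lattice.Properties.MeetSemilattice as MeetSemilatticeProperties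
import Relation.Binary.Lattice.Properties.JoinSemilattice as JoinSemilatticeProperties

open Equivalence using (to; from)

module GaloisConnections {c ℓ₁ ℓ₂} (P : Poset c ℓ₁ ℓ₂) where
  open Poset P

  module Residuation {l u : Carrier → Carrier}
                     (l⊣u : ∀ a b → (l a ≤ b) ⇔ (a ≤ u b)) where
    unit : ∀ a → a ≤ u (l a)
    unit a = to (l⊣u a (l a)) refl

    counit : ∀ b → l (u b) ≤ b
    counit b = from (l⊣u (u b) b) refl

    l-monotone : ∀ {a b} → a ≤ b → l a ≤ l b
    l-monotone {a} {b} a≤b = from (l⊣u a (l b)) (trans a≤b (unit b))

    u-monotone : ∀ {a b} → a ≤ b → u a ≤ u b
    u-monotone {a} {b} a≤b = to (l⊣u (u a) b) (trans (counit a) a≤b)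

  module Antitone {f g : Carrier → Carrier}
                  (f⇄g : ∀ a b → (a ≤ f b) ⇔ (b ≤ g a)) where
    ≤f∘g : ∀ a → a ≤ f (g a)
    ≤f∘g a = from (f⇄g a (g a)) refl

    ≤g∘f : ∀ b → b ≤ g (f b)
    ≤g∘f b = to (f⇄g (f b) b) refl

    g-antitone : ∀ {a b} → a ≤ b → g b ≤ g a
    g-antitone {a} {b} a≤b = to (f⇄g a (g b)) (trans a≤b (≤f∘g b))

  module DualAntitone {f g : Carrier → Carrier}
                      (f⇄g : ∀ a b → (f a ≤ b) ⇔ (g b ≤ a)) where
    f∘g≤ : ∀ b → f (g b) ≤ b
    f∘g≤ b = from (f⇄g (g b) b) refl

    g∘f≤ : ∀ a → g (f a) ≤ a
    g∘f≤ a = to (f⇄g a (f a)) refl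

    g-antitone : ∀ {a b} → a ≤ b → g b ≤ g a
    g-antitone {a} {b} a≤b = to (f⇄g (g a) b) (trans (f∘g≤ a) a≤b)

module LatticeProperties {c ℓ₁ ℓ₂} (L : BDLattice c ℓ₁ ℓ₂) where
  open BDLattice L public
  open MeetSemilatticeProperties meetSemilattice public using (∧-monotonic; ∧-comm)
  open JoinSemilatticeProperties joinSemilattice public using (∨-monotonic; ∨-comm)
  open GaloisConnections poset public
  open ≤-Reasoning poset public

  module HeytingProperties (H : HeytingImp L) where
    open HeytingImp H public

    transpose-⇒ : ∀ {a b c} → a ∧ b ≤ c → b ≤ a ⇒ c
    transpose-⇒ {a} {b} {c} = to (residual a b c)

    transpose-∧ : ∀ {a b c} → b ≤ a ⇒ c → a ∧ b ≤ c
    transpose-∧ {a} {b} {c} = from (residual a b c)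

    ⇒-eval : ∀ a b → a ∧ (a ⇒ b) ≤ b
    ⇒-eval a b = transpose-∧ refl

  module CoHeytingProperties (K : CoHeytingImp L) where
    open CoHeytingImp K public

    transpose-∸ : ∀ {a b c} → a ≤ b ∨ c → a ∸ b ≤ c
    transpose-∸ {a} {b} {c} = to (residual a b c)

    transpose-∨ : ∀ {a b c} → a ∸ b ≤ c → a ≤ b ∨ c
    transpose-∨ {a} {b} {c} = from (residual a b c)

    ∸-coeval : ∀ a b → a ≤ b ∨ (a ∸ b)
    ∸-coeval a b = transpose-∨ refl

module _ {c ℓ₁ ℓ₂} (L : BDLattice c ℓ₁ ℓ₂) where
  open LatticeProperties L
  open ModalPair using (fwd; bwd)

  ◇⁺□⁺-locality⇔ : (Δ : ModalPair L box pos) (∇ : ModalPair L dia pos)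
                   (H : HeytingImp L) →
                   FwdEq L dia pos pos (bwd Δ) (bwd ∇) ⇔
                   BwdEq L dia pos pos H (fwd Δ) (fwd ∇)
  ◇⁺□⁺-locality⇔ Δ ∇ H = mk⇔ fwd⇒bwd bwd⇒fwd
    where
    open HeytingProperties H
    open ModalPair Δ using () renaming (fwd to D; bwd to d; adj to Δ-adj)
    open ModalPair ∇ using () renaming (fwd to N; bwd to n; adj to ∇-adj)
    module d⊣D = Residuation (λ a b → ⇔.sym (Δ-adj a b))
    module N⊣n = Residuation ∇-adj

    fwd⇒bwd : FwdEq L dia pos pos d n → BwdEq L dia pos pos H D N
    fwd⇒bwd F a b = from (Δ-adj _ _) (transpose-⇒ (begin
      a ∧ d x           ≤⟨ ∧-monotonic (N⊣n.unit a) refl ⟩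
      n (N a) ∧ d x     ≤⟨ F (N a) x ⟩
      d (N a ∧ x)       ≤⟨ d⊣D.l-monotone (⇒-eval (N a) (D b)) ⟩
      d (D b)           ≤⟨ d⊣D.counit b ⟩
      b                 ∎))
      where
      x : Carrier
      x = N a ⇒ D b

    bwd⇒fwd : BwdEq L dia pos pos H D N → FwdEq L dia pos pos d n
    bwd⇒fwd B a b = transpose-∧ (to (Δ-adj _ _) (begin
      b                       ≤⟨ transpose-⇒ N∘n∧≤D∘d ⟩
      N (n a) ⇒ D (d (a ∧ b)) ≤⟨ B (n a) (d (a ∧ b)) ⟩
      D (n a ⇒ d (a ∧ b))     ∎))
      where
      N∘n∧≤D∘d : N (n a) ∧ b ≤ D (d (a ∧ b))
      N∘n∧≤D∘d = begin
        N (n a) ∧ b   ≤⟨ ∧-monotonic (N⊣n.counit a) refl ⟩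
        a ∧ b         ≤⟨ d⊣D.unit (a ∧ b) ⟩
        D (d (a ∧ b)) ∎

  ◇⁻□⁻-locality⇔ : (Δ : ModalPair L dia neg) (∇ : ModalPair L box neg)
                   (H : HeytingImp L) (K : CoHeytingImp L) →
                   FwdEq L dia neg neg (bwd Δ) (bwd ∇) ⇔
                   BwdEq L dia neg neg (H , K) (fwd Δ) (fwd ∇)
  ◇⁻□⁻-locality⇔ Δ ∇ H K = mk⇔ fwd⇒bwd bwd⇒fwd
    where
    open HeytingProperties H
    open CoHeytingProperties K
    open ModalPair Δ using () renaming (fwd to D; bwd to d; adj to Δ-adj)
    open ModalPair ∇ using () renaming (fwd to N; bwd to n; adj to ∇-adj)
    module D⇄d = DualAntitone Δ-adj
    module N⇄n = Antitone ∇-adj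

    fwd⇒bwd : FwdEq L dia neg neg d n → BwdEq L dia neg neg (H , K) D N
    fwd⇒bwd F a b = from (Δ-adj _ _) (transpose-⇒ (begin
      a ∧ d y           ≤⟨ ∧-monotonic (N⇄n.≤g∘f a) refl ⟩
      n (N a) ∧ d y     ≤⟨ F (N a) y ⟩
      d (N a ∨ y)       ≤⟨ D⇄d.g-antitone (∸-coeval (D b) (N a)) ⟩
      d (D b)           ≤⟨ D⇄d.g∘f≤ b ⟩
      b                 ∎))
      where
      y : Carrier
      y = D b ∸ N a

    bwd⇒fwd : BwdEq L dia neg neg (H , K) D N → FwdEq L dia neg neg d n
    bwd⇒fwd B a b = transpose-∧ (to (Δ-adj _ _) (begin
      D (n a ⇒ d (a ∨ b))     ≤⟨ B (n a) (d (a ∨ b)) ⟩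
      D (d (a ∨ b)) ∸ N (n a) ≤⟨ transpose-∸ D∘d≤N∘n∨ ⟩
      b                       ∎))
      where
      D∘d≤N∘n∨ : D (d (a ∨ b)) ≤ N (n a) ∨ b
      D∘d≤N∘n∨ = begin
        D (d (a ∨ b)) ≤⟨ D⇄d.f∘g≤ (a ∨ b) ⟩
        a ∨ b         ≤⟨ ∨-monotonic (N⇄n.≤f∘g a) refl ⟩
        N (n a) ∨ b   ∎

  □⁺◇⁺-locality⇔ : (Δ : ModalPair L dia pos) (∇ : ModalPair L box pos)
                   (K : CoHeytingImp L) →
                   FwdEq L box pos pos (bwd Δ) (bwd ∇) ⇔
                   BwdEq L box pos pos K (fwd Δ) (fwd ∇)
  □⁺◇⁺-locality⇔ Δ ∇ K = mk⇔ fwd⇒bwd bwd⇒fwd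
    where
    open CoHeytingProperties K
    open ModalPair Δ using () renaming (fwd to D; bwd to d; adj to Δ-adj)
    open ModalPair ∇ using () renaming (fwd to N; bwd to n; adj to ∇-adj)
    module D⊣d = Residuation Δ-adj
    module n⊣N = Residuation (λ a b → ⇔.sym (∇-adj a b))

    fwd⇒bwd : FwdEq L box pos pos d n → BwdEq L box pos pos K D N
    fwd⇒bwd F a b = from (Δ-adj _ _) (transpose-∸ (begin
      b               ≤⟨ D⊣d.unit b ⟩
      d (D b)         ≤⟨ D⊣d.u-monotone D≤y∨N ⟩
      d (y ∨ N a)     ≤⟨ F y (N a) ⟩
      d y ∨ n (N a)   ≤⟨ ∨-monotonic refl (n⊣N.counit a) ⟩
      d y ∨ a         ≈⟨ ∨-comm (d y) a ⟩
      a ∨ d y         ∎))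
      where
      y : Carrier
      y = D b ∸ N a
      D≤y∨N : D b ≤ y ∨ N a
      D≤y∨N = begin
        D b       ≤⟨ ∸-coeval (D b) (N a) ⟩
        N a ∨ y   ≈⟨ ∨-comm (N a) y ⟩
        y ∨ N a   ∎

    bwd⇒fwd : BwdEq L box pos pos K D N → FwdEq L box pos pos d n
    bwd⇒fwd B a b = begin
      d (a ∨ b)  ≤⟨ transpose-∨ (to (Δ-adj _ _) (begin
        D (d (a ∨ b) ∸ n b)     ≤⟨ B (n b) (d (a ∨ b)) ⟩
        D (d (a ∨ b)) ∸ N (n b) ≤⟨ transpose-∸ D∘d≤N∘n∨ ⟩
        a                       ∎)) ⟩
      n b ∨ d a  ≈⟨ ∨-comm (n b) (d a) ⟩
      d a ∨ n b  ∎
      where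
      D∘d≤N∘n∨ : D (d (a ∨ b)) ≤ N (n b) ∨ a
      D∘d≤N∘n∨ = begin
        D (d (a ∨ b)) ≤⟨ D⊣d.counit (a ∨ b) ⟩
        a ∨ b         ≈⟨ ∨-comm a b ⟩
        b ∨ a         ≤⟨ ∨-monotonic (n⊣N.unit b) refl ⟩
        N (n b) ∨ a   ∎

  □⁻◇⁻-locality⇔ : (Δ : ModalPair L box neg) (∇ : ModalPair L dia neg)
                   (H : HeytingImp L) (K : CoHeytingImp L) →
                   FwdEq L box neg neg (bwd Δ) (bwd ∇) ⇔
                   BwdEq L box neg neg (H , K) (fwd Δ) (fwd ∇)
  □⁻◇⁻-locality⇔ Δ ∇ H K = mk⇔ fwd⇒bwd bwd⇒fwd
    where
    open HeytingProperties H
    open CoHeytingProperties K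
    open ModalPair Δ using () renaming (fwd to D; bwd to d; adj to Δ-adj)
    open ModalPair ∇ using () renaming (fwd to N; bwd to n; adj to ∇-adj)
    module D⇄d = Antitone Δ-adj
    module N⇄n = DualAntitone ∇-adj

    fwd⇒bwd : FwdEq L box neg neg d n → BwdEq L box neg neg (H , K) D N
    fwd⇒bwd F a b = from (Δ-adj _ _) (transpose-∸ (begin
      b               ≤⟨ D⇄d.≤g∘f b ⟩
      d (D b)         ≤⟨ D⇄d.g-antitone x∧N≤D ⟩
      d (x ∧ N a)     ≤⟨ F x (N a) ⟩
      d x ∨ n (N a)   ≤⟨ ∨-monotonic refl (N⇄n.g∘f≤ a) ⟩
      d x ∨ a         ≈⟨ ∨-comm (d x) a ⟩
      a ∨ d x         ∎))
      where
      x : Carrier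
      x = N a ⇒ D b
      x∧N≤D : x ∧ N a ≤ D b
      x∧N≤D = begin
        x ∧ N a   ≈⟨ ∧-comm x (N a) ⟩
        N a ∧ x   ≤⟨ ⇒-eval (N a) (D b) ⟩
        D b       ∎

    bwd⇒fwd : BwdEq L box neg neg (H , K) D N → FwdEq L box neg neg d n
    bwd⇒fwd B a b = begin
      d (a ∧ b)  ≤⟨ transpose-∨ (to (Δ-adj _ _) (begin
        a                       ≤⟨ transpose-⇒ N∘n∧≤D∘d ⟩
        N (n b) ⇒ D (d (a ∧ b)) ≤⟨ B (n b) (d (a ∧ b)) ⟩
        D (d (a ∧ b) ∸ n b)     ∎)) ⟩
      n b ∨ d a  ≈⟨ ∨-comm (n b) (d a) ⟩
      d a ∨ n b  ∎
      where
      N∘n∧≤D∘d : N (n b) ∧ a ≤ D (d (a ∧ b))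
      N∘n∧≤D∘d = begin
        N (n b) ∧ a   ≈⟨ ∧-comm (N (n b)) a ⟩
        a ∧ N (n b)   ≤⟨ ∧-monotonic refl (N⇄n.f∘g≤ b) ⟩
        a ∧ b         ≤⟨ D⇄d.≤f∘g (a ∧ b) ⟩
        D (d (a ∧ b)) ∎

  ◇⁺□⁻-locality⇔ : (Δ : ModalPair L box pos) (∇ : ModalPair L box neg)
                   (H : HeytingImp L) →
                   FwdEq L dia pos neg (bwd Δ) (bwd ∇) ⇔
                   BwdEq L dia pos neg H (fwd Δ) (fwd ∇)
  ◇⁺□⁻-locality⇔ Δ ∇ H = mk⇔ fwd⇒bwd bwd⇒fwd
    where
    open HeytingProperties H
    open ModalPair Δ using () renaming (fwd to D; bwd to d; adj to Δ-adj)
    open ModalPair ∇ using () renaming (fwd to N; bwd to n; adj to ∇-adj)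
    module N⇄n = Antitone ∇-adj

    fwd⇒bwd : FwdEq L dia pos neg d n → BwdEq L dia pos neg H D N
    fwd⇒bwd F a = from (Δ-adj _ _) (transpose-⇒ (begin
      a ∧ d (N a)       ≤⟨ ∧-monotonic (N⇄n.≤g∘f a) refl ⟩
      n (N a) ∧ d (N a) ≤⟨ F (N a) ⟩
      ⊥                 ∎))

    bwd⇒fwd : BwdEq L dia pos neg H D N → FwdEq L dia pos neg d n
    bwd⇒fwd B a = transpose-∧ (to (Δ-adj _ _) (begin
      a             ≤⟨ N⇄n.≤f∘g a ⟩
      N (n a)       ≤⟨ B (n a) ⟩
      D (n a ⇒ ⊥)   ∎))

  ◇⁻□⁺-locality⇔ : (Δ : ModalPair L dia neg) (∇ : ModalPair L dia pos)
                   (H : HeytingImp L) →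
                   FwdEq L dia neg pos (bwd Δ) (bwd ∇) ⇔
                   BwdEq L dia neg pos H (fwd Δ) (fwd ∇)
  ◇⁻□⁺-locality⇔ Δ ∇ H = mk⇔ fwd⇒bwd bwd⇒fwd
    where
    open HeytingProperties H
    open ModalPair Δ using () renaming (fwd to D; bwd to d; adj to Δ-adj)
    open ModalPair ∇ using () renaming (fwd to N; bwd to n; adj to ∇-adj)
    module N⊣n = Residuation ∇-adj

    fwd⇒bwd : FwdEq L dia neg pos d n → BwdEq L dia neg pos H D N
    fwd⇒bwd F a = from (Δ-adj _ _) (transpose-⇒ (begin
      a ∧ d (N a)       ≤⟨ ∧-monotonic (N⊣n.unit a) refl ⟩
      n (N a) ∧ d (N a) ≤⟨ F (N a) ⟩
      ⊥                 ∎))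

    bwd⇒fwd : BwdEq L dia neg pos H D N → FwdEq L dia neg pos d n
    bwd⇒fwd B a = transpose-∧ (to (Δ-adj _ _) (begin
      D (n a ⇒ ⊥)   ≤⟨ B (n a) ⟩
      N (n a)       ≤⟨ N⊣n.counit a ⟩
      a             ∎))

  □⁺◇⁻-locality⇔ : (Δ : ModalPair L dia pos) (∇ : ModalPair L dia neg)
                   (K : CoHeytingImp L) →
                   FwdEq L box pos neg (bwd Δ) (bwd ∇) ⇔
                   BwdEq L box pos neg K (fwd Δ) (fwd ∇)
  □⁺◇⁻-locality⇔ Δ ∇ K = mk⇔ fwd⇒bwd bwd⇒fwd
    where
    open CoHeytingProperties K
    open ModalPair Δ using () renaming (fwd to D; bwd to d; adj to Δ-adj)
    open ModalPair ∇ using () renaming (fwd to N; bwd to n; adj to ∇-adj)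
    module N⇄n = DualAntitone ∇-adj

    fwd⇒bwd : FwdEq L box pos neg d n → BwdEq L box pos neg K D N
    fwd⇒bwd F a = from (Δ-adj _ _) (transpose-∸ (begin
      ⊤                 ≤⟨ F (N a) ⟩
      d (N a) ∨ n (N a) ≤⟨ ∨-monotonic refl (N⇄n.g∘f≤ a) ⟩
      d (N a) ∨ a       ≈⟨ ∨-comm (d (N a)) a ⟩
      a ∨ d (N a)       ∎))

    bwd⇒fwd : BwdEq L box pos neg K D N → FwdEq L box pos neg d n
    bwd⇒fwd B a = begin
      ⊤          ≤⟨ transpose-∨ (to (Δ-adj _ _) (begin
        D (⊤ ∸ n a) ≤⟨ B (n a) ⟩
        N (n a)     ≤⟨ N⇄n.f∘g≤ a ⟩
        a           ∎)) ⟩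
      n a ∨ d a  ≈⟨ ∨-comm (n a) (d a) ⟩
      d a ∨ n a  ∎

  □⁻◇⁺-locality⇔ : (Δ : ModalPair L box neg) (∇ : ModalPair L box pos)
                   (K : CoHeytingImp L) →
                   FwdEq L box neg pos (bwd Δ) (bwd ∇) ⇔
                   BwdEq L box neg pos K (fwd Δ) (fwd ∇)
  □⁻◇⁺-locality⇔ Δ ∇ K = mk⇔ fwd⇒bwd bwd⇒fwd
    where
    open CoHeytingProperties K
    open ModalPair Δ using () renaming (fwd to D; bwd to d; adj to Δ-adj)
    open ModalPair ∇ using () renaming (fwd to N; bwd to n; adj to ∇-adj)
    module n⊣N = Residuation (λ a b → ⇔.sym (∇-adj a b))

    fwd⇒bwd : FwdEq L box neg pos d n → BwdEq L box neg pos K D N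
    fwd⇒bwd F a = from (Δ-adj _ _) (transpose-∸ (begin
      ⊤                 ≤⟨ F (N a) ⟩
      d (N a) ∨ n (N a) ≤⟨ ∨-monotonic refl (n⊣N.counit a) ⟩
      d (N a) ∨ a       ≈⟨ ∨-comm (d (N a)) a ⟩
      a ∨ d (N a)       ∎))

    bwd⇒fwd : BwdEq L box neg pos K D N → FwdEq L box neg pos d n
    bwd⇒fwd B a = begin
      ⊤          ≤⟨ transpose-∨ (to (Δ-adj _ _) (begin
        a           ≤⟨ n⊣N.unit a ⟩
        N (n a)     ≤⟨ B (n a) ⟩
        D (⊤ ∸ n a) ∎)) ⟩
      n a ∨ d a  ≈⟨ ∨-comm (n a) (d a) ⟩
      d a ∨ n a  ∎

open TenseAlg using (lattice; m₁; m₂)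

mainTheorem9 : ∀ {c ℓ₁ ℓ₂} (s : Shape) (α β : Pol)
    (A : TenseAlg c ℓ₁ ℓ₂ (dual s α) α (dual (flip s) β) β)
    (ap : Appropriate (TenseAlg.lattice A) s α β) →
    FwdEq (TenseAlg.lattice (adjoint A)) s α β
          (TenseAlg.fwd₁ (adjoint A)) (TenseAlg.fwd₂ (adjoint A))
    ⇔ BwdEq (TenseAlg.lattice A) s α β ap (TenseAlg.fwd₁ A) (TenseAlg.fwd₂ A)
mainTheorem9 dia pos pos A H       = ◇⁺□⁺-locality⇔ (lattice A) (m₁ A) (m₂ A) H
mainTheorem9 dia neg neg A (H , K) = ◇⁻□⁻-locality⇔ (lattice A) (m₁ A) (m₂ A) H K
mainTheorem9 box pos pos A K       = □⁺◇⁺-locality⇔ (lattice A) (m₁ A) (m₂ A) K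
mainTheorem9 box neg neg A (H , K) = □⁻◇⁻-locality⇔ (lattice A) (m₁ A) (m₂ A) H K
mainTheorem9 dia pos neg A H       = ◇⁺□⁻-locality⇔ (lattice A) (m₁ A) (m₂ A) H
mainTheorem9 dia neg pos A H       = ◇⁻□⁺-locality⇔ (lattice A) (m₁ A) (m₂ A) H
mainTheorem9 box pos neg A K       = □⁺◇⁻-locality⇔ (lattice A) (m₁ A) (m₂ A) K
mainTheorem9 box neg pos A K       = □⁻◇⁺-locality⇔ (lattice A) (m₁ A) (m₂ A) K
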